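{- Let $r \in \mathcal{D}$ with $r \neq 1$ be a lone term, i.e. $r$ belongs to no triplet of $\mathcal{D}$. Define $S_0 = \{r\}$ and $S_{k+1} = \bigcup_{d \in S_k} \{4d-1, 4d+1, 4d+3\}$ for $k \ge 0$. Then every element of $\bigcup_{k\ge 0} S_k$ belongs to $\mathcal{D}$, $|S_k| = 3^k$ for all $k$ (so the sets $\{4d-1,4d+1,4d+3\}$, $d \in S_k$, are pairwise disjoint and the elements with the parent-to-child edges $d \to 4d-1, 4d+1, 4d+3$ form an infinite directed ternary tree with root $r$), and every element of $S_k$ has binary length $\ell + 2k$, where $\ell$ is the binary length of $r$; in particular all nodes of the tree lie in ranges of the same parity as the range of $r$.
   Context: Let $\mathcal{D}$ (OEIS A036991) be the set of positive integers $m$ such that, in the binary expansion of $m$ written without leading zeros, every suffix contains at least as many digits $1$ as digits $0$. The binary length of $m$ is the number of its binary digits; the $n$-range is the set of elements of $\mathcal{D}$ of binary length $n$. A triplet of $\mathcal{D}$ is a triple $(t-4,t-2,t)$ of integers all belonging to $\mathcal{D}$. -}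

module Defs where

open import Data.Nat using (ℕ; zero; suc; _+_; _*_; _∸_; _≤_; _<_; _%_; _/_; _≡ᵇ_)
open import Data.Bool using (Bool; true; false; if_then_else_)
open import Data.List using (List; []; _∷_; [_]; take; length; concatMap; filterᵇ)
open import Data.Product using (_×_; Σ)
open import Data.Sum using (_⊎_)
open import Relation.Binary.PropositionalEquality using (_≡_)
open import Relation.Nullary using (¬_)
open import Data.Bool using (not)

-- Binary digits of m, least significant digit first, without leading zeros
-- (bits 0 = []).  The fuel argument (initially m) is always sufficient,
-- since m has at most m binary digits.
bitsFuel : ℕ → ℕ → List Bool
bitsFuel zero    m = []
bitsFuel (suc f) zero = []
bitsFuel (suc f) m@(suc _) = (m % 2 ≡ᵇ 1) ∷ bitsFuel f (m / 2)

bits : ℕ → List Bool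
bits m = bitsFuel m m

binLength : ℕ → ℕ
binLength m = length (bits m)

ones : List Bool → ℕ
ones bs = length (filterᵇ (λ b → b) bs)

zeros : List Bool → ℕ
zeros bs = length (filterᵇ not bs)

-- m ∈ 𝒟 (A036991): m positive and every suffix of its binary expansion
-- (written most significant digit first) has at least as many 1s as 0s.
-- Suffixes of the MSB-first word are exactly the prefixes (take j) of the
-- LSB-first list 'bits m'.
InD : ℕ → Set
InD m = (0 < m) × (∀ j → zeros (take j (bits m)) ≤ ones (take j (bits m)))

-- (t-4, t-2, t) is a triplet of 𝒟.  Since InD 0 is false, this forces t ≥ 5,
-- so the truncated subtractions are genuine subtractions.
Triplet : ℕ → Set
Triplet t = InD (t ∸ 4) × InD (t ∸ 2) × InD t

Lone : ℕ → Set
Lone r = ¬ Σ ℕ (λ t → Triplet t × (r ≡ t ∸ 4 ⊎ r ≡ t ∸ 2 ⊎ r ≡ t))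

children : ℕ → List ℕ
children d = (4 * d ∸ 1) ∷ (4 * d + 1) ∷ (4 * d + 3) ∷ []

-- S r k as a list (with multiplicity); S_k is its underlying set.
S : ℕ → ℕ → List ℕ
S r zero    = [ r ]
S r (suc k) = concatMap children (S r k)

{-# OPTIONS --safe #-}
-- An element d ≠ 1 of 𝒟 is odd, d = 2A + 1 with A ≥ 1, and the suffix
-- condition for d says that every suffix of the binary word of A has at most
-- one more 0 than 1s.  The children 4d − 1, 4d + 1, 4d + 3 are 8A + 3, 8A + 5,
-- 8A + 7, whose binary words are that of A followed by 011, 101 and 111; each
-- of these three endings restores the suffix condition, and each child has
-- two more digits than d.  Distinct elements of S_k are at distance at least
-- 2, so listing S_k in increasing order, the children of its elements again
-- come in increasing order at distance at least 2; in particular they are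
-- pairwise distinct and |S_{k+1}| = 3 |S_k|.
module Submission where

open import Defs
open import Data.Nat using (ℕ; _+_; _*_; _^_)
open import Data.Nat.Properties using ()
open import Data.List using (length)
open import Data.List.Membership.Propositional using (_∈_)
open import Data.List.Relation.Unary.Unique.Propositional using (Unique)
open import Data.Product using (_×_)
open import Relation.Binary.PropositionalEquality using (_≡_; _≢_)

open import Data.Bool using (Bool; true; false)
open import Data.Nat using (zero; suc; _∸_; _≤_; _<_; _%_; _/_; _≡ᵇ_; z≤n; s≤s)
open import Data.Nat.Properties
open import Data.Nat.DivMod using (m/n<m; [m+kn]%n≡m%n; +-distrib-/-∣ʳ; m*n/n≡m)
open import Data.Nat.Divisibility using (m∣m*n)
open import Data.Nat.Tactic.RingSolver using (solve-∀)
open import Data.List using (List; []; _∷_; _++_; take; concatMap)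
open import Data.List.Properties using (length-++)
open import Data.List.Membership.Propositional using (find)
open import Data.List.Membership.Propositional.Properties using (∈-concatMap⁻)
open import Data.List.Relation.Unary.Any using (here; there)
open import Data.List.Relation.Unary.All using (All; []; _∷_; tabulate)
import Data.List.Relation.Unary.AllPairs as AllPairs
open import Data.List.Relation.Unary.Linked as Linked using (Linked; []; [-]; _∷_)
open import Data.List.Relation.Unary.Linked.Properties using (Linked⇒AllPairs; ++⁺)
open import Data.Maybe.Relation.Binary.Connected using (just; just-nothing)
open import Data.Product using (Σ-syntax; _,_; proj₁; proj₂)
open import Data.Empty using (⊥-elim)
open import Relation.Nullary using (¬_)
open import Relation.Binary.PropositionalEquality using (refl; sym; trans; cong; cong₂; subst; module ≡-Reasoning)

suc/2≤ : ∀ m → suc m / 2 ≤ m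
suc/2≤ m = ≤-pred (m/n<m (suc m) 2 (s≤s (s≤s z≤n)))

bitsFuel-irrelevant : ∀ {f g} m → m ≤ f → m ≤ g → bitsFuel f m ≡ bitsFuel g m
bitsFuel-irrelevant {zero}  {zero}  zero    _       _       = refl
bitsFuel-irrelevant {zero}  {suc g} zero    _       _       = refl
bitsFuel-irrelevant {suc f} {zero}  zero    _       _       = refl
bitsFuel-irrelevant {suc f} {suc g} zero    _       _       = refl
bitsFuel-irrelevant {suc f} {suc g} (suc m) (s≤s m≤f) (s≤s m≤g) =
  cong (_ ∷_) (bitsFuel-irrelevant (suc m / 2) (≤-trans (suc/2≤ m) m≤f) (≤-trans (suc/2≤ m) m≤g))

bits-positive : ∀ {m} → 0 < m → bits m ≡ (m % 2 ≡ᵇ 1) ∷ bits (m / 2)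
bits-positive {suc m} _ =
  cong ((suc m % 2 ≡ᵇ 1) ∷_) (bitsFuel-irrelevant (suc m / 2) (suc/2≤ m) ≤-refl)

bit : Bool → ℕ
bit false = 0
bit true  = 1

bit+2*-% : ∀ b n → (bit b + 2 * n) % 2 ≡ bit b
bit+2*-% b n = trans (cong (λ x → (bit b + x) % 2) (*-comm 2 n)) (bit+n*2-% b)
  where
  bit+n*2-% : ∀ b → (bit b + n * 2) % 2 ≡ bit b
  bit+n*2-% false = [m+kn]%n≡m%n 0 n 2
  bit+n*2-% true  = [m+kn]%n≡m%n 1 n 2

bit+2*-/ : ∀ b n → (bit b + 2 * n) / 2 ≡ n
bit+2*-/ b n = begin
  (bit b + 2 * n) / 2     ≡⟨ +-distrib-/-∣ʳ (bit b) (m∣m*n n) ⟩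
  bit b / 2 + 2 * n / 2   ≡⟨ cong₂ _+_ (bit/2 b) (trans (cong (_/ 2) (*-comm 2 n)) (m*n/n≡m n 2)) ⟩
  n                       ∎
  where
  open ≡-Reasoning
  bit/2 : ∀ b → bit b / 2 ≡ 0
  bit/2 false = refl
  bit/2 true  = refl

bit≡ᵇ1 : ∀ b → (bit b ≡ᵇ 1) ≡ b
bit≡ᵇ1 false = refl
bit≡ᵇ1 true  = refl

bits-bit+2* : ∀ b n → 0 < bit b + 2 * n → bits (bit b + 2 * n) ≡ b ∷ bits n
bits-bit+2* b n pos = begin
  bits (bit b + 2 * n)                                        ≡⟨ bits-positive pos ⟩
  ((bit b + 2 * n) % 2 ≡ᵇ 1) ∷ bits ((bit b + 2 * n) / 2)    ≡⟨ cong₂ (λ x y → (x ≡ᵇ 1) ∷ bits y) (bit+2*-% b n) (bit+2*-/ b n) ⟩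
  (bit b ≡ᵇ 1) ∷ bits n                                       ≡⟨ cong (_∷ bits n) (bit≡ᵇ1 b) ⟩
  b ∷ bits n                                                  ∎
  where open ≡-Reasoning

bit+2*-positive : ∀ b {n} → 0 < n → 0 < bit b + 2 * n
bit+2*-positive b {n} n>0 = <-≤-trans n>0 (≤-trans (m≤m+n n (n + 0)) (m≤n+m (2 * n) (bit b)))

binary-digit : ∀ d → Σ[ b ∈ Bool ] Σ[ n ∈ ℕ ] d ≡ bit b + 2 * n
binary-digit zero = false , 0 , refl
binary-digit (suc d) with binary-digit d
... | false , n , refl = true , n , refl
... | true  , n , refl = false , suc n , cong suc (sym (+-suc n (n + 0)))

-- InD m unfolds to 0 < m × Balanced 0 (bits m).
Balanced : ℕ → List Bool → Set
Balanced c bs = ∀ j → zeros (take j bs) ≤ c + ones (take j bs)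

true∷-balanced : ∀ {c bs} → Balanced (suc c) bs → Balanced c (true ∷ bs)
true∷-balanced bal zero = z≤n
true∷-balanced {c} {bs} bal (suc j) = subst (zeros (take j bs) ≤_) (sym (+-suc c _)) (bal j)

true∷-balanced⁻ : ∀ {c bs} → Balanced c (true ∷ bs) → Balanced (suc c) bs
true∷-balanced⁻ {c} {bs} bal j = subst (zeros (take j bs) ≤_) (+-suc c _) (bal (suc j))

false∷-balanced : ∀ {c bs} → Balanced c bs → Balanced (suc c) (false ∷ bs)
false∷-balanced bal zero    = z≤n
false∷-balanced bal (suc j) = s≤s (bal j)

false∷-unbalanced : ∀ {bs} → ¬ Balanced 0 (false ∷ bs)
false∷-unbalanced bal with bal 1
... | ()

balanced-mono : ∀ {c d bs} → c ≤ d → Balanced c bs → Balanced d bs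
balanced-mono c≤d bal j = ≤-trans (bal j) (+-monoˡ-≤ _ c≤d)

InD⇒odd : ∀ {d} → InD d → d ≢ 1 → Σ[ A ∈ ℕ ] d ≡ 1 + 2 * A × 0 < A × Balanced 1 (bits A)
InD⇒odd {d} (d>0 , bal) d≢1 with binary-digit d
... | false , n , refl =
  ⊥-elim (false∷-unbalanced (subst (Balanced 0) (bits-bit+2* false n d>0) bal))
... | true , zero , refl = ⊥-elim (d≢1 refl)
... | true , suc a , refl =
  suc a , refl , s≤s z≤n , true∷-balanced⁻ (subst (Balanced 0) (bits-bit+2* true (suc a) d>0) bal)

bits-three-digits : ∀ b₀ b₁ b₂ {A} → 0 < A →
  bits (bit b₀ + 2 * (bit b₁ + 2 * (bit b₂ + 2 * A))) ≡ b₀ ∷ b₁ ∷ b₂ ∷ bits A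
bits-three-digits b₀ b₁ b₂ {A} A>0 = begin
  bits (bit b₀ + 2 * (bit b₁ + 2 * (bit b₂ + 2 * A))) ≡⟨ bits-bit+2* b₀ _ (bit+2*-positive b₀ pos₁) ⟩
  b₀ ∷ bits (bit b₁ + 2 * (bit b₂ + 2 * A))           ≡⟨ cong (b₀ ∷_) (bits-bit+2* b₁ _ pos₁) ⟩
  b₀ ∷ b₁ ∷ bits (bit b₂ + 2 * A)                     ≡⟨ cong (λ bs → b₀ ∷ b₁ ∷ bs) (bits-bit+2* b₂ _ pos₂) ⟩
  b₀ ∷ b₁ ∷ b₂ ∷ bits A                               ∎
  where
  open ≡-Reasoning
  pos₂ : 0 < bit b₂ + 2 * A
  pos₂ = bit+2*-positive b₂ A>0
  pos₁ : 0 < bit b₁ + 2 * (bit b₂ + 2 * A)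
  pos₁ = bit+2*-positive b₁ pos₂

InD-three-digits : ∀ {A c} b₀ b₁ b₂ → 0 < A →
  c ≡ bit b₀ + 2 * (bit b₁ + 2 * (bit b₂ + 2 * A)) → Balanced 0 (b₀ ∷ b₁ ∷ b₂ ∷ bits A) →
  InD c × binLength c ≡ 3 + binLength A
InD-three-digits b₀ b₁ b₂ A>0 refl bal =
  (bit+2*-positive b₀ (bit+2*-positive b₁ (bit+2*-positive b₂ A>0)) , subst (Balanced 0) (sym digits) bal) ,
  cong length digits
  where digits = bits-three-digits b₀ b₁ b₂ A>0

children-of-odd : ∀ {A c} → 0 < A → Balanced 1 (bits A) → c ∈ children (1 + 2 * A) →
  InD c × binLength c ≡ 3 + binLength A
children-of-odd {A} A>0 bal (here refl) =
  InD-three-digits true true false A>0 (cong (_∸ 1) (8A+3 A))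
    (true∷-balanced (true∷-balanced (false∷-balanced bal)))
  where
  8A+3 : ∀ A → 4 * (1 + 2 * A) ≡ 1 + (1 + 2 * (1 + 2 * (0 + 2 * A)))
  8A+3 = solve-∀
children-of-odd {A} A>0 bal (there (here refl)) =
  InD-three-digits true false true A>0 (8A+5 A)
    (true∷-balanced (false∷-balanced (true∷-balanced bal)))
  where
  8A+5 : ∀ A → 4 * (1 + 2 * A) + 1 ≡ 1 + 2 * (0 + 2 * (1 + 2 * A))
  8A+5 = solve-∀
children-of-odd {A} A>0 bal (there (there (here refl))) =
  InD-three-digits true true true A>0 (8A+7 A)
    (true∷-balanced (true∷-balanced (true∷-balanced (balanced-mono (s≤s z≤n) bal))))
  where
  8A+7 : ∀ A → 4 * (1 + 2 * A) + 3 ≡ 1 + 2 * (1 + 2 * (1 + 2 * A))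
  8A+7 = solve-∀

children-InD : ∀ {d c} → InD d → d ≢ 1 → c ∈ children d →
  (InD c × c ≢ 1) × binLength c ≡ 2 + binLength d
children-InD d∈D d≢1 c∈ with InD⇒odd d∈D d≢1
... | A , refl , A>0 , bal with children-of-odd A>0 bal c∈
...   | c∈D , len = (c∈D , λ { refl → 1≢3+ len }) , trans len (cong (2 +_) (sym len-d))
  where
  1≢3+ : ∀ {n} → 1 ≢ 3 + n
  1≢3+ ()
  len-d : binLength (1 + 2 * A) ≡ 1 + binLength A
  len-d = cong length (bits-bit+2* true A (s≤s z≤n))

infix 4 _≪_
_≪_ : ℕ → ℕ → Set
m ≪ n = 2 + m ≤ n

≪⇒< : ∀ {m n} → m ≪ n → m < n
≪⇒< = <⇒≤

∸1≪+1 : ∀ {x} → 0 < x → x ∸ 1 ≪ x + 1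
∸1≪+1 {suc x} _ = s≤s (≤-reflexive (+-comm 1 x))

children-≪ : ∀ {d} → 0 < d → Linked _≪_ (children d)
children-≪ {d} d>0 =
  ∸1≪+1 (<-≤-trans d>0 (m≤n*m d 4)) ∷ ≤-reflexive (+1+2 (4 * d)) ∷ [-]
  where
  +1+2 : ∀ x → 2 + (x + 1) ≡ x + 3
  +1+2 = solve-∀

last-child≪first-child : ∀ {d d'} → d ≪ d' → 4 * d + 3 ≪ 4 * d' ∸ 1
last-child≪first-child {d} {d'} d≪d' = m+n≤o⇒m≤o∸n (2 + (4 * d + 3)) (begin
  2 + (4 * d + 3) + 1      ≤⟨ m≤m+n _ 2 ⟩
  2 + (4 * d + 3) + 1 + 2  ≡⟨ +8 d ⟩
  4 * (2 + d)              ≤⟨ *-monoʳ-≤ 4 d≪d' ⟩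
  4 * d'                   ∎)
  where
  open ≤-Reasoning
  +8 : ∀ d → 2 + (4 * d + 3) + 1 + 2 ≡ 4 * (2 + d)
  +8 = solve-∀

concatMap-children-≪ : ∀ {L} → All (0 <_) L → Linked _≪_ L → Linked _≪_ (concatMap children L)
concatMap-children-≪ [] [] = []
concatMap-children-≪ (d>0 ∷ []) [-] = ++⁺ (children-≪ d>0) just-nothing []
concatMap-children-≪ (d>0 ∷ d'>0 ∷ ps) (d≪d' ∷ lk) =
  ++⁺ (children-≪ d>0) (just (last-child≪first-child d≪d')) (concatMap-children-≪ (d'>0 ∷ ps) lk)

length-concatMap-const : ∀ {A B : Set} {f : A → List B} k → (∀ x → length (f x) ≡ k) →
  ∀ xs → length (concatMap f xs) ≡ k * length xs
length-concatMap-const k len-f [] = sym (*-zeroʳ k)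
length-concatMap-const {f = f} k len-f (x ∷ xs) = begin
  length (f x ++ concatMap f xs)          ≡⟨ length-++ (f x) ⟩
  length (f x) + length (concatMap f xs)  ≡⟨ cong₂ _+_ (len-f x) (length-concatMap-const k len-f xs) ⟩
  k + k * length xs                       ≡⟨ sym (*-suc k _) ⟩
  k * length (x ∷ xs)                     ∎
  where
  open ≡-Reasoning

length-S : ∀ r k → length (S r k) ≡ 3 ^ k
length-S r zero    = refl
length-S r (suc k) = trans (length-concatMap-const 3 (λ _ → refl) (S r k)) (cong (3 *_) (length-S r k))

module _ {r : ℕ} (r∈D : InD r) (r≢1 : r ≢ 1) where

  S-InD : ∀ k {x} → x ∈ S r k → (InD x × x ≢ 1) × binLength x ≡ binLength r + 2 * k
  S-InD zero (here refl) = (r∈D , r≢1) , sym (+-identityʳ _)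
  S-InD (suc k) x∈ with find (∈-concatMap⁻ children x∈)
  ... | d , d∈ , x∈children with S-InD k d∈
  ...   | (d∈D , d≢1) , len-d with children-InD d∈D d≢1 x∈children
  ...     | x∈D , len-x = x∈D , trans len-x (trans (cong (2 +_) len-d) (+2 (binLength r) k))
    where
    +2 : ∀ l k → 2 + (l + 2 * k) ≡ l + 2 * suc k
    +2 = solve-∀

  S-≪ : ∀ k → Linked _≪_ (S r k)
  S-≪ zero    = [-]
  S-≪ (suc k) = concatMap-children-≪ (tabulate (λ d∈ → proj₁ (proj₁ (proj₁ (S-InD k d∈))))) (S-≪ k)

  S-unique : ∀ k → Unique (S r k)
  S-unique k = AllPairs.map <⇒≢ (Linked⇒AllPairs <-trans (Linked.map ≪⇒< (S-≪ k)))

proposition12 : (r : ℕ) → InD r → r ≢ 1 → Lone r →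
    ((k x : ℕ) → x ∈ S r k → InD x)
    × ((k : ℕ) → Unique (S r k) × length (S r k) ≡ 3 ^ k)
    × ((k x : ℕ) → x ∈ S r k → binLength x ≡ binLength r + 2 * k)
proposition12 r r∈D r≢1 _ =
  (λ k x x∈ → proj₁ (proj₁ (S-InD r∈D r≢1 k x∈))) ,
  (λ k → S-unique r∈D r≢1 k , length-S r k) ,
  (λ k x x∈ → proj₂ (S-InD r∈D r≢1 k x∈))
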